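{- Let $G$ be a finite, simple, undirected, connected graph that contains no triangle $K_3$ and has no pair of false-twin vertices. Let $v$ be a vertex with $d(v)=k$. Then $v$ belongs to at least $k$ different bicliques of $G$.
   Context: All graphs are finite, simple, undirected and connected (standing assumption of the paper). A biclique of $G$ is a maximal (with respect to vertex-set inclusion) induced subgraph of $G$ that is a complete bipartite graph $K_{p,q}$ with $p,q\geq 1$; bicliques are counted as distinct vertex sets. $N(v)$ is the open neighborhood and $d(v)=|N(v)|$. Two distinct vertices $u,w$ are false-twins if $N(u)=N(w)$. -}

module Defs where

open import Data.Nat using (ℕ)
open import Data.Bool using (Bool; true; false)
open import Data.Fin using (Fin)
open import Data.Fin.Subset using (Subset; _∈_; _∉_; _⊂_; ∣_∣; Nonempty)
open import Data.Vec using (tabulate)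
open import Data.Product using (_×_; ∃)
open import Data.Sum using (_⊎_)
open import Data.Empty using (⊥)
open import Relation.Nullary using (¬_)
open import Relation.Binary.PropositionalEquality using (_≡_; _≢_)
open import Function.Bundles using (_⇔_)

record Graph (n : ℕ) : Set where
  field
    adj    : Fin n → Fin n → Bool
    sym    : ∀ x y → adj x y ≡ adj y x
    irrefl : ∀ x → adj x x ≡ false
open Graph public

module _ {n : ℕ} (G : Graph n) where

  Adj : Fin n → Fin n → Set
  Adj x y = adj G x y ≡ true

  data Walk : Fin n → Fin n → Set where
    here : ∀ {x} → Walk x x
    step : ∀ {x y z} → Adj x y → Walk y z → Walk x z

  Connected : Set
  Connected = ∀ x y → Walk x y

  TriangleFree : Set
  TriangleFree = ∀ x y z → Adj x y → Adj y z → Adj x z → ⊥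

  FalseTwins : Fin n → Fin n → Set
  FalseTwins u w = u ≢ w × (∀ x → adj G u x ≡ adj G w x)

  NoFalseTwins : Set
  NoFalseTwins = ∀ u w → ¬ FalseTwins u w

  N : Fin n → Subset n
  N v = tabulate (adj G v)

  degree : Fin n → ℕ
  degree v = ∣ N v ∣

  InducesCompleteBipartite : Subset n → Set
  InducesCompleteBipartite S =
    ∃ λ (A : Subset n) → ∃ λ (B : Subset n) →
      (∀ x → (x ∈ S) ⇔ (x ∈ A ⊎ x ∈ B)) ×
      (∀ x → x ∈ A → x ∉ B) ×
      Nonempty A × Nonempty B ×
      (∀ x y → x ∈ S → y ∈ S →
        Adj x y ⇔ ((x ∈ A × y ∈ B) ⊎ (x ∈ B × y ∈ A)))

  IsBiclique : Subset n → Set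
  IsBiclique S = InducesCompleteBipartite S ×
                 (∀ S′ → S ⊂ S′ → ¬ InducesCompleteBipartite S′)

module Submission where

-- For a neighbour w of v, let D(w) = {u : N(w) ⊆ N(u)} (so w ∈ D(w)). In a
-- triangle-free graph D(w) and N(w) are independent sets, completely joined to
-- each other, so D(w) ∪ N(w) induces a complete bipartite graph containing v;
-- it is maximal because any vertex on w's side of a larger complete bipartite
-- graph sees all of N(w), and any vertex on the other side is adjacent to w.
-- Distinct neighbours w, w′ of v give distinct sets: otherwise, as w′ ∉ N(w)
-- (no triangle v w w′), we get N(w) ⊆ N(w′) and symmetrically, so w and w′
-- would be false twins.

open import Defs
open import Data.Nat using (ℕ; zero; suc)
open import Data.Bool using (Bool; true; _≟_)
open import Data.Fin using (Fin)
open import Data.Fin.Properties using () renaming (_≟_ to _≟ᶠ_)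
open import Data.Fin.Subset using (Subset; _∈_; _∉_; _⊆_; _⊂_; _∪_)
open import Data.Fin.Subset.Properties using (_⊆?_; ⊆-antisym; ∪⇔⊎)
open import Data.Vec using (tabulate; lookup; count)
open import Data.Vec.Properties using ([]=⇒lookup; lookup⇒[]=; lookup∘tabulate)
open import Data.List as List using (List; length; map; filter; allFin)
open import Data.List.Properties using (length-map)
open import Data.List.Relation.Unary.All as All using (All; []; _∷_)
open import Data.List.Relation.Unary.All.Properties using (all-filter; map⁺)
open import Data.List.Relation.Unary.Unique.Propositional using (Unique; []; _∷_)
import Data.List.Relation.Unary.Unique.Propositional.Properties as Unique
open import Data.Product using (_×_; ∃; _,_)
open import Data.Sum using (_⊎_; inj₁; inj₂; swap)
open import Function using (_∘_)
open import Function.Bundles using (_⇔_; mk⇔; Equivalence)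
open import Relation.Nullary using (¬_; Dec; does; yes; no; contradiction)
open import Relation.Nullary.Decidable using (dec-true)
open import Relation.Unary using (Pred; Decidable)
open import Relation.Binary.PropositionalEquality using (_≡_; refl; trans; cong; subst; module ≡-Reasoning)
  renaming (sym to ≡-sym)

open Equivalence using (to; from)

does≡true⇔ : ∀ {a} {A : Set a} (a? : Dec A) → does a? ≡ true ⇔ A
does≡true⇔ (yes a) = mk⇔ (λ _ → a) (λ _ → refl)
does≡true⇔ a?@(no ¬a) = mk⇔ (λ ()) (dec-true a?)

∈-tabulate⇔ : ∀ {n} {f : Fin n → Bool} {x} → x ∈ tabulate f ⇔ f x ≡ true
∈-tabulate⇔ {f = f} {x} = mk⇔
  (λ x∈ → trans (≡-sym (lookup∘tabulate f x)) ([]=⇒lookup x∈))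
  (λ fx → lookup⇒[]= x (tabulate f) (trans (lookup∘tabulate f x) fx))

length-filter-tabulate : ∀ {a b p} {A : Set a} {B : Set b} {P : Pred A p} (P? : Decidable P)
  (f : B → A) {n} (g : Fin n → B) →
  length (filter (λ x → P? (f x)) (List.tabulate g)) ≡ count P? (tabulate (f ∘ g))
length-filter-tabulate P? f {zero} g = refl
length-filter-tabulate P? f {suc n} g with P? (f (g Fin.zero))
... | yes _ = cong suc (length-filter-tabulate P? f (g ∘ Fin.suc))
... | no _  = length-filter-tabulate P? f (g ∘ Fin.suc)

unique-map⁺-on : ∀ {a b p} {A : Set a} {B : Set b} {P : Pred A p} {f : A → B} →
  (∀ {x y} → P x → P y → f x ≡ f y → x ≡ y) →
  ∀ {xs} → All P xs → Unique xs → Unique (map f xs)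
unique-map⁺-on inj [] [] = []
unique-map⁺-on inj (px ∷ pxs) (x∉xs ∷ xs!) =
  map⁺ (All.zipWith (λ (py , x≢y) → x≢y ∘ inj px py) (pxs , x∉xs))
  ∷ unique-map⁺-on inj pxs xs!

module _ {n : ℕ} (G : Graph n) where

  Adj-sym : ∀ {x y} → Adj G x y → Adj G y x
  Adj-sym {x} {y} xy = trans (Graph.sym G y x) xy

  Adj-irrefl : ∀ {x} → ¬ Adj G x x
  Adj-irrefl {x} xx with () ← trans (≡-sym xx) (Graph.irrefl G x)

  ∈N⇔Adj : ∀ {w x} → x ∈ N G w ⇔ Adj G w x
  ∈N⇔Adj = ∈-tabulate⇔

  neighbours : Fin n → List (Fin n)
  neighbours v = filter (λ x → adj G v x ≟ true) (allFin n)

  length-neighbours : ∀ v → length (neighbours v) ≡ degree G v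
  length-neighbours v = length-filter-tabulate (_≟ true) (adj G v) (λ x → x)

  neighbours-unique : ∀ v → Unique (neighbours v)
  neighbours-unique v = Unique.filter⁺ _ (Unique.allFin⁺ n)

  neighbours-adjacent : ∀ v → All (Adj G v) (neighbours v)
  neighbours-adjacent v = all-filter _ (allFin n)

  Dominators : Fin n → Subset n
  Dominators w = tabulate (λ u → does (N G w ⊆? N G u))

  ∈Dominators⇔ : ∀ {w u} → u ∈ Dominators w ⇔ N G w ⊆ N G u
  ∈Dominators⇔ {w} {u} = mk⇔
    (to (does≡true⇔ (N G w ⊆? N G u)) ∘ to ∈-tabulate⇔)
    (from ∈-tabulate⇔ ∘ from (does≡true⇔ (N G w ⊆? N G u)))

  dominatorBiclique : Fin n → Subset n
  dominatorBiclique w = Dominators w ∪ N G w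

  w∈Dominators : ∀ w → w ∈ Dominators w
  w∈Dominators w = from ∈Dominators⇔ (λ x∈ → x∈)

  Dominators-N-disjoint : ∀ {w x} → x ∈ Dominators w → x ∉ N G w
  Dominators-N-disjoint x∈D x∈N = Adj-irrefl (to ∈N⇔Adj (to ∈Dominators⇔ x∈D x∈N))

  Dominators-N-adjacent : ∀ {w x y} → x ∈ Dominators w → y ∈ N G w → Adj G x y
  Dominators-N-adjacent x∈D y∈N = to ∈N⇔Adj (to ∈Dominators⇔ x∈D y∈N)

  ∈dominatorBiclique⇔ : ∀ {w x} → x ∈ dominatorBiclique w ⇔ (x ∈ Dominators w ⊎ x ∈ N G w)
  ∈dominatorBiclique⇔ = ∪⇔⊎

  ⊆-dominatorBiclique : ∀ {w S′ P Q} → dominatorBiclique w ⊆ S′ → w ∈ P → w ∉ Q →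
    (∀ {x} → x ∈ S′ → x ∈ P ⊎ x ∈ Q) →
    (∀ {x y} → x ∈ S′ → y ∈ S′ → Adj G x y ⇔ ((x ∈ P × y ∈ Q) ⊎ (x ∈ Q × y ∈ P))) →
    S′ ⊆ dominatorBiclique w
  ⊆-dominatorBiclique {w} {S′} {P} {Q} S⊆S′ w∈P w∉Q cover adjacency {x} x∈S′ = absorb (cover x∈S′)
    where
      w∈S′ : w ∈ S′
      w∈S′ = S⊆S′ (from ∈dominatorBiclique⇔ (inj₁ (w∈Dominators w)))

      N[w]⊆N[x] : x ∈ P → N G w ⊆ N G x
      N[w]⊆N[x] x∈P y∈N with y∈S′ ← S⊆S′ (from ∈dominatorBiclique⇔ (inj₂ y∈N))
                          | to (adjacency w∈S′ y∈S′) (to ∈N⇔Adj y∈N)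
      ... | inj₁ (_ , y∈Q) = from ∈N⇔Adj (from (adjacency x∈S′ y∈S′) (inj₁ (x∈P , y∈Q)))
      ... | inj₂ (w∈Q , _) = contradiction w∈Q w∉Q

      absorb : x ∈ P ⊎ x ∈ Q → x ∈ dominatorBiclique w
      absorb (inj₁ x∈P) = from ∈dominatorBiclique⇔ (inj₁ (from ∈Dominators⇔ (N[w]⊆N[x] x∈P)))
      absorb (inj₂ x∈Q) =
        from ∈dominatorBiclique⇔ (inj₂ (from ∈N⇔Adj (from (adjacency w∈S′ x∈S′) (inj₁ (w∈P , x∈Q)))))

  dominatorBiclique-maximal : ∀ w S′ → dominatorBiclique w ⊂ S′ → ¬ InducesCompleteBipartite G S′
  dominatorBiclique-maximal w S′ (S⊆S′ , x , x∈S′ , x∉S) (A , B , cover , disjoint , _ , _ , adjacency)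
    with to (cover w) (S⊆S′ (from ∈dominatorBiclique⇔ (inj₁ (w∈Dominators w))))
  ... | inj₁ w∈A = x∉S (⊆-dominatorBiclique S⊆S′ w∈A (disjoint w w∈A)
                          (to (cover _)) (adjacency _ _) x∈S′)
  ... | inj₂ w∈B = x∉S (⊆-dominatorBiclique S⊆S′ w∈B (λ w∈A → disjoint w w∈A w∈B)
                          (swap ∘ to (cover _)) adjacency-swapped x∈S′)
    where
      adjacency-swapped : ∀ {x y} → x ∈ S′ → y ∈ S′ → Adj G x y ⇔ ((x ∈ B × y ∈ A) ⊎ (x ∈ A × y ∈ B))
      adjacency-swapped x∈S′ y∈S′ =
        mk⇔ (swap ∘ to (adjacency _ _ x∈S′ y∈S′)) (from (adjacency _ _ x∈S′ y∈S′) ∘ swap)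

  module _ (triangleFree : TriangleFree G) where

    Dominators-independent : ∀ {w v x y} → v ∈ N G w →
      x ∈ Dominators w → y ∈ Dominators w → ¬ Adj G x y
    Dominators-independent v∈N x∈D y∈D xy =
      triangleFree _ _ _ xy (Dominators-N-adjacent y∈D v∈N) (Dominators-N-adjacent x∈D v∈N)

    N-independent : ∀ {w x y} → x ∈ N G w → y ∈ N G w → ¬ Adj G x y
    N-independent x∈N y∈N xy = triangleFree _ _ _ (to ∈N⇔Adj x∈N) xy (to ∈N⇔Adj y∈N)

    dominatorBiclique-induces : ∀ {w v} → v ∈ N G w →
      InducesCompleteBipartite G (dominatorBiclique w)
    dominatorBiclique-induces {w} {v} v∈N =
      Dominators w , N G w , (λ _ → ∈dominatorBiclique⇔) , (λ _ → Dominators-N-disjoint) ,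
      (w , w∈Dominators w) , (v , v∈N) ,
      λ x y x∈S y∈S → mk⇔ (sides (to ∈dominatorBiclique⇔ x∈S) (to ∈dominatorBiclique⇔ y∈S)) adjacent
      where
        sides : ∀ {x y} → x ∈ Dominators w ⊎ x ∈ N G w → y ∈ Dominators w ⊎ y ∈ N G w → Adj G x y →
          (x ∈ Dominators w × y ∈ N G w) ⊎ (x ∈ N G w × y ∈ Dominators w)
        sides (inj₁ x∈D) (inj₁ y∈D) xy = contradiction xy (Dominators-independent v∈N x∈D y∈D)
        sides (inj₁ x∈D) (inj₂ y∈N) _  = inj₁ (x∈D , y∈N)
        sides (inj₂ x∈N) (inj₁ y∈D) _  = inj₂ (x∈N , y∈D)
        sides (inj₂ x∈N) (inj₂ y∈N) xy = contradiction xy (N-independent x∈N y∈N)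

        adjacent : ∀ {x y} → (x ∈ Dominators w × y ∈ N G w) ⊎ (x ∈ N G w × y ∈ Dominators w) → Adj G x y
        adjacent (inj₁ (x∈D , y∈N)) = Dominators-N-adjacent x∈D y∈N
        adjacent (inj₂ (x∈N , y∈D)) = Adj-sym (Dominators-N-adjacent y∈D x∈N)

    dominatorBiclique-isBiclique : ∀ {w v} → v ∈ N G w → IsBiclique G (dominatorBiclique w)
    dominatorBiclique-isBiclique v∈N = dominatorBiclique-induces v∈N , dominatorBiclique-maximal _

    dominatorBiclique-≡⇒N-⊆ : ∀ {v w w′} → Adj G v w → Adj G v w′ →
      dominatorBiclique w ≡ dominatorBiclique w′ → N G w ⊆ N G w′
    dominatorBiclique-≡⇒N-⊆ {v} {w} {w′} vw vw′ S≡S′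
      with to ∈dominatorBiclique⇔ (subst (w′ ∈_) (≡-sym S≡S′)
                                   (from ∈dominatorBiclique⇔ (inj₁ (w∈Dominators w′))))
    ... | inj₁ w′∈D = to ∈Dominators⇔ w′∈D
    ... | inj₂ w′∈N = contradiction (to ∈N⇔Adj w′∈N)
                        (N-independent (from ∈N⇔Adj vw) (from ∈N⇔Adj vw′))

  N-injective : NoFalseTwins G → ∀ {u w} → N G u ≡ N G w → u ≡ w
  N-injective noTwins {u} {w} N≡N with u ≟ᶠ w
  ... | yes u≡w = u≡w
  ... | no u≢w = contradiction (u≢w , same-adjacency) (noTwins u w)
    where
      same-adjacency : ∀ x → adj G u x ≡ adj G w x
      same-adjacency x = begin
        adj G u x            ≡⟨ lookup∘tabulate (adj G u) x ⟨
        lookup (N G u) x     ≡⟨ cong (λ S → lookup S x) N≡N ⟩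
        lookup (N G w) x     ≡⟨ lookup∘tabulate (adj G w) x ⟩
        adj G w x            ∎
        where open ≡-Reasoning

  dominatorBiclique-injectiveOn : TriangleFree G → NoFalseTwins G → ∀ {v w w′} →
    Adj G v w → Adj G v w′ → dominatorBiclique w ≡ dominatorBiclique w′ → w ≡ w′
  dominatorBiclique-injectiveOn triangleFree noTwins vw vw′ S≡S′ =
    N-injective noTwins (⊆-antisym (dominatorBiclique-≡⇒N-⊆ triangleFree vw vw′ S≡S′)
                                   (dominatorBiclique-≡⇒N-⊆ triangleFree vw′ vw (≡-sym S≡S′)))

lemma4p3 : ∀ (n : ℕ) (G : Graph n) → Connected G → TriangleFree G → NoFalseTwins G →
    ∀ (v : Fin n) (k : ℕ) → degree G v ≡ k →
    ∃ λ (Bs : List (Subset n)) →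
      length Bs ≡ k × Unique Bs × All (λ S → IsBiclique G S × v ∈ S) Bs
lemma4p3 n G _ triangleFree noTwins v k degree≡k =
  map (dominatorBiclique G) (neighbours G v) ,
  trans (length-map _ (neighbours G v)) (trans (length-neighbours G v) degree≡k) ,
  unique-map⁺-on (dominatorBiclique-injectiveOn G triangleFree noTwins)
                 (neighbours-adjacent G v) (neighbours-unique G v) ,
  map⁺ (All.map containing-v (neighbours-adjacent G v))
  where
    containing-v : ∀ {w} → Adj G v w → IsBiclique G (dominatorBiclique G w) × v ∈ dominatorBiclique G w
    containing-v vw = dominatorBiclique-isBiclique G triangleFree v∈N , from (∈dominatorBiclique⇔ G) (inj₂ v∈N)
      where
        v∈N : v ∈ N G _
        v∈N = from (∈N⇔Adj G) (Adj-sym G vw)
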